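{- For every $\mathcal{L}_2$-formula $A$: $\mathbf{GR}^-\vdash A^\top$ if and only if $\mathbf{GR}^\circ\vdash A^\top$. Consequently, $\mathbf{GR}^-\vdash A^\top$ if and only if $\mathbf{GR}^\circ\vdash A$.
   Context: $\mathcal{L}_2$ is the bimodal propositional language with countably many propositional variables, $\bot$, connectives $\neg,\vee$ (others defined), and unary modal operators $\Box,\blacksquare$; $\Diamond$ abbreviates $\neg\Box\neg$. The logic $\mathbf{GR}^-$ has as axioms all propositional tautologies of $\mathcal{L}_2$ and all instances of $\Box(A\to B)\to(\Box A\to\Box B)$, $\Box(\Box A\to A)\to\Box A$, $\blacksquare A\to\Box A$, $\Box A\to\Box\blacksquare A$, $\Box A\to(\Box\bot\vee\blacksquare A)$, $\Diamond\blacksquare A\to\Diamond A$, and rules modus ponens and $\Box$-necessitation. $\mathbf{GR}^\circ$ is $\mathbf{GR}^-$ plus the rule: from $A$ infer $\blacksquare A$. The set $S_0(A)$ of $\blacksquare$-outermost subformulas of $A$ is defined by: $S_0(B)=\{B\}$ if $B$ is a variable, $\bot$, or of the form $\blacksquare C$; $S_0(B\vee C)=S_0(B)\cup S_0(C)\cup\{B\vee C\}$; $S_0(\neg B)=S_0(B)\cup\{\neg B\}$; $S_0(\Box B)=S_0(B)\cup\{\Box B\}$. $A^\top$ is the formula obtained from $A$ by replacing every $\blacksquare D\in S_0(A)$ with $\mathbf{GR}^\circ\vdash D$ by $\neg\bot$. -}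

module Defs where

open import Data.Nat using (ℕ)
open import Data.Bool using (Bool; true; false; not; _∨_)
open import Relation.Binary.PropositionalEquality using (_≡_)
open import Relation.Nullary using (¬_)

data Fm : Set where
  var  : ℕ → Fm
  ⊥'   : Fm
  ¬'_  : Fm → Fm
  _∨'_ : Fm → Fm → Fm
  □_   : Fm → Fm
  ■_   : Fm → Fm

infixr 6 _∨'_
infixr 5 _⇒_
infix 7 ¬'_ □_ ■_ ◇_

_⇒_ : Fm → Fm → Fm
A ⇒ B = (¬' A) ∨' B

⊤' : Fm
⊤' = ¬' ⊥'

◇_ : Fm → Fm
◇ A = ¬' (□ (¬' A))

-- Propositional (truth-functional) evaluation: formulas of the form
-- var n, □ B, ■ B are treated as propositional atoms.
eval : (Fm → Bool) → Fm → Bool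
eval v (var n)  = v (var n)
eval v ⊥'       = false
eval v (¬' A)   = not (eval v A)
eval v (A ∨' B) = eval v A ∨ eval v B
eval v (□ A)    = v (□ A)
eval v (■ A)    = v (■ A)

Taut : Fm → Set
Taut A = (v : Fm → Bool) → eval v A ≡ true

data GR⁻⊢_ : Fm → Set where
  taut  : ∀ {A} → Taut A → GR⁻⊢ A
  axK   : ∀ A B → GR⁻⊢ (□ (A ⇒ B) ⇒ (□ A ⇒ □ B))
  axL   : ∀ A → GR⁻⊢ (□ (□ A ⇒ A) ⇒ □ A)
  ax1   : ∀ A → GR⁻⊢ (■ A ⇒ □ A)
  ax2   : ∀ A → GR⁻⊢ (□ A ⇒ □ (■ A))
  ax3   : ∀ A → GR⁻⊢ (□ A ⇒ ((□ ⊥') ∨' (■ A)))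
  ax4   : ∀ A → GR⁻⊢ (◇ (■ A) ⇒ ◇ A)
  mp    : ∀ {A B} → GR⁻⊢ (A ⇒ B) → GR⁻⊢ A → GR⁻⊢ B
  nec   : ∀ {A} → GR⁻⊢ A → GR⁻⊢ (□ A)

data GR°⊢_ : Fm → Set where
  taut  : ∀ {A} → Taut A → GR°⊢ A
  axK   : ∀ A B → GR°⊢ (□ (A ⇒ B) ⇒ (□ A ⇒ □ B))
  axL   : ∀ A → GR°⊢ (□ (□ A ⇒ A) ⇒ □ A)
  ax1   : ∀ A → GR°⊢ (■ A ⇒ □ A)
  ax2   : ∀ A → GR°⊢ (□ A ⇒ □ (■ A))
  ax3   : ∀ A → GR°⊢ (□ A ⇒ ((□ ⊥') ∨' (■ A)))
  ax4   : ∀ A → GR°⊢ (◇ (■ A) ⇒ ◇ A)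
  mp    : ∀ {A B} → GR°⊢ (A ⇒ B) → GR°⊢ A → GR°⊢ B
  nec   : ∀ {A} → GR°⊢ A → GR°⊢ (□ A)
  bnec  : ∀ {A} → GR°⊢ A → GR°⊢ (■ A)

-- IsTop A B : "B is A^⊤", i.e. B arises from A by replacing every
-- ■-outermost subformula ■D of A (element of S₀(A)) with GR° ⊢ D by ¬⊥,
-- and leaving it unchanged otherwise.  Since GR°-provability need not be
-- constructively decidable, A^⊤ is given as a (functional) relation.
data IsTop : Fm → Fm → Set where
  t-var  : ∀ n → IsTop (var n) (var n)
  t-⊥    : IsTop ⊥' ⊥'
  t-¬    : ∀ {A A'} → IsTop A A' → IsTop (¬' A) (¬' A')
  t-∨    : ∀ {A A' B B'} → IsTop A A' → IsTop B B' → IsTop (A ∨' B) (A' ∨' B')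
  t-□    : ∀ {A A'} → IsTop A A' → IsTop (□ A) (□ A')
  t-■yes : ∀ {D} → GR°⊢ D → IsTop (■ D) ⊤'
  t-■no  : ∀ {D} → ¬ (GR°⊢ D) → IsTop (■ D) (■ D)

-- GR° extends GR⁻ only by ■-necessitation. An application of it inside the
-- scope of a □-necessitation is harmless, because GR° ⊢ A already gives
-- GR⁻ ⊢ □A and then GR⁻ ⊢ □■A by ax2. Any other application, to a formula A,
-- can only be simulated in GR⁻ as ■A ∨ □⊥ (by ax3), so we weaken every
-- ■-outermost ■A of a GR°-proof to ■A ∨ □⊥ for such A and obtain a GR⁻-proof.
-- All such A are GR°-theorems, whereas the ■-outermost ■D left in Aᵀ have D
-- unprovable in GR°; hence the weakening leaves Aᵀ unchanged and GR° ⊢ Aᵀ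
-- implies GR⁻ ⊢ Aᵀ. Finally GR° ⊢ A ↔ Aᵀ, since GR° ⊢ ■D ↔ ⊤ whenever GR° ⊢ D.
module Submission where

open import Defs
open import Data.Bool using (Bool; true; false; not; _∨_; _∧_; T; if_then_else_)
open import Data.Bool.Properties using (∨-inverseˡ; T-∧)
open import Data.Empty using (⊥-elim)
open import Data.List using (List; []; _∷_; _++_)
open import Data.List.Membership.Propositional using (_∈_)
open import Data.List.Membership.Propositional.Properties using (∈-++⁺ˡ; ∈-++⁺ʳ; ∈-++⁻)
open import Data.List.Relation.Binary.Subset.Propositional using (_⊆_)
open import Data.List.Relation.Unary.Any using (here)
open import Data.Nat using (ℕ; zero; suc) renaming (_≟_ to _≟ℕ_)
open import Data.Product using (_×_; _,_; proj₁; proj₂)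
open import Data.Sum using ([_,_])
open import Function using (_∘_; id)
open import Function.Bundles using (_⇔_; mk⇔; Equivalence)
open import Relation.Binary.Definitions using (DecidableEquality)
open import Relation.Binary.PropositionalEquality using (_≡_; refl; cong; cong₂; trans; subst)
open import Relation.Nullary using (yes; no; does)
open import Relation.Nullary.Decidable using (map′; _×-dec_)

infix 4 _≟_

_≟_ : DecidableEquality Fm
var m ≟ var n = map′ (cong var) (λ { refl → refl }) (m ≟ℕ n)
⊥' ≟ ⊥' = yes refl
(¬' A) ≟ (¬' B) = map′ (cong ¬'_) (λ { refl → refl }) (A ≟ B)
(A ∨' B) ≟ (C ∨' D) =
  map′ (λ (p , q) → cong₂ _∨'_ p q) (λ { refl → refl , refl }) (A ≟ C ×-dec B ≟ D)
(□ A) ≟ (□ B) = map′ (cong □_) (λ { refl → refl }) (A ≟ B)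
(■ A) ≟ (■ B) = map′ (cong ■_) (λ { refl → refl }) (A ≟ B)
var _ ≟ ⊥' = no λ ()
var _ ≟ (¬' _) = no λ ()
var _ ≟ (_ ∨' _) = no λ ()
var _ ≟ (□ _) = no λ ()
var _ ≟ (■ _) = no λ ()
⊥' ≟ var _ = no λ ()
⊥' ≟ (¬' _) = no λ ()
⊥' ≟ (_ ∨' _) = no λ ()
⊥' ≟ (□ _) = no λ ()
⊥' ≟ (■ _) = no λ ()
(¬' _) ≟ var _ = no λ ()
(¬' _) ≟ ⊥' = no λ ()
(¬' _) ≟ (_ ∨' _) = no λ ()
(¬' _) ≟ (□ _) = no λ ()
(¬' _) ≟ (■ _) = no λ ()
(_ ∨' _) ≟ var _ = no λ ()
(_ ∨' _) ≟ ⊥' = no λ ()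
(_ ∨' _) ≟ (¬' _) = no λ ()
(_ ∨' _) ≟ (□ _) = no λ ()
(_ ∨' _) ≟ (■ _) = no λ ()
(□ _) ≟ var _ = no λ ()
(□ _) ≟ ⊥' = no λ ()
(□ _) ≟ (¬' _) = no λ ()
(□ _) ≟ (_ ∨' _) = no λ ()
(□ _) ≟ (■ _) = no λ ()
(■ _) ≟ var _ = no λ ()
(■ _) ≟ ⊥' = no λ ()
(■ _) ≟ (¬' _) = no λ ()
(■ _) ≟ (_ ∨' _) = no λ ()
(■ _) ≟ (□ _) = no λ ()

open import Data.List.Membership.DecPropositional _≟_ using (_∈?_)

infixr 7 _∧'_

_∧'_ : Fm → Fm → Fm
A ∧' B = ¬' (¬' A ∨' ¬' B)

BoolFun : ℕ → Set
BoolFun zero    = Bool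
BoolFun (suc n) = Bool → BoolFun n

Valid : ∀ n → BoolFun n → Set
Valid zero    b = b ≡ true
Valid (suc n) f = ∀ a → Valid n (f a)

all-true : ∀ n → BoolFun n → Bool
all-true zero    b = b
all-true (suc n) f = all-true n (f true) ∧ all-true n (f false)

truth-table : ∀ n {f} → T (all-true n f) → Valid n f
truth-table zero    {true} _ = refl
truth-table (suc n) {f} t a with Equivalence.to (T-∧ {all-true n (f true)}) t
truth-table (suc n) {f} t true  | t-true , _ = truth-table n t-true
truth-table (suc n) {f} t false | _ , t-false = truth-table n t-false

record ContainsK (⊢_ : Fm → Set) : Set where
  field
    tautology     : ∀ {A} → Taut A → ⊢ A
    modus-ponens  : ∀ {A B} → ⊢ (A ⇒ B) → ⊢ A → ⊢ B
    distribution  : ∀ A B → ⊢ (□ (A ⇒ B) ⇒ (□ A ⇒ □ B))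
    necessitation : ∀ {A} → ⊢ A → ⊢ (□ A)

module ContainsK-Properties {⊢_ : Fm → Set} (L : ContainsK ⊢_) where
  open ContainsK L

  ⊤-intro : ⊢ ⊤'
  ⊤-intro = tautology λ _ → refl

  ⊥-elim′ : ∀ {A} → ⊢ (⊥' ⇒ A)
  ⊥-elim′ = tautology λ _ → refl

  ⇒-refl : ∀ {A} → ⊢ (A ⇒ A)
  ⇒-refl {A} = tautology λ v → ∨-inverseˡ (eval v A)

  ⇒-const : ∀ {A B} → ⊢ B → ⊢ (A ⇒ B)
  ⇒-const {A} {B} = modus-ponens (tautology λ v → table (eval v A) (eval v B))
    where
    table : ∀ a b → not b ∨ (not a ∨ b) ≡ true
    table = truth-table 2 _

  ⇒-trans : ∀ {A B C} → ⊢ (A ⇒ B) → ⊢ (B ⇒ C) → ⊢ (A ⇒ C)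
  ⇒-trans {A} {B} {C} A⇒B B⇒C =
    modus-ponens (modus-ponens (tautology λ v → table (eval v A) (eval v B) (eval v C)) A⇒B) B⇒C
    where
    table : ∀ a b c → not (not a ∨ b) ∨ (not (not b ∨ c) ∨ (not a ∨ c)) ≡ true
    table = truth-table 3 _

  ¬-mono : ∀ {A B} → ⊢ (A ⇒ B) → ⊢ (¬' B ⇒ ¬' A)
  ¬-mono {A} {B} = modus-ponens (tautology λ v → table (eval v A) (eval v B))
    where
    table : ∀ a b → not (not a ∨ b) ∨ (not (not b) ∨ not a) ≡ true
    table = truth-table 2 _

  ∨-injˡ : ∀ {A B} → ⊢ (A ⇒ A ∨' B)
  ∨-injˡ {A} {B} = tautology λ v → table (eval v A) (eval v B)
    where
    table : ∀ a b → not a ∨ (a ∨ b) ≡ true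
    table = truth-table 2 _

  ∨-comm : ∀ {A B} → ⊢ (A ∨' B ⇒ B ∨' A)
  ∨-comm {A} {B} = tautology λ v → table (eval v A) (eval v B)
    where
    table : ∀ a b → not (a ∨ b) ∨ (b ∨ a) ≡ true
    table = truth-table 2 _

  ∨-mono : ∀ {A A′ B B′} → ⊢ (A ⇒ A′) → ⊢ (B ⇒ B′) → ⊢ (A ∨' B ⇒ A′ ∨' B′)
  ∨-mono {A} {A′} {B} {B′} A⇒A′ B⇒B′ =
    modus-ponens (modus-ponens (tautology λ v → table (eval v A) (eval v A′) (eval v B) (eval v B′)) A⇒A′) B⇒B′
    where
    table : ∀ a a′ b b′ →
            not (not a ∨ a′) ∨ (not (not b ∨ b′) ∨ (not (a ∨ b) ∨ (a′ ∨ b′))) ≡ true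
    table = truth-table 4 _

  ∨-elim : ∀ {A B C} → ⊢ (A ⇒ C) → ⊢ (B ⇒ C) → ⊢ (A ∨' B ⇒ C)
  ∨-elim {A} {B} {C} A⇒C B⇒C =
    modus-ponens (modus-ponens (tautology λ v → table (eval v A) (eval v B) (eval v C)) A⇒C) B⇒C
    where
    table : ∀ a b c → not (not a ∨ c) ∨ (not (not b ∨ c) ∨ (not (a ∨ b) ∨ c)) ≡ true
    table = truth-table 3 _

  ∧-elimˡ : ∀ {A B} → ⊢ (A ∧' B ⇒ A)
  ∧-elimˡ {A} {B} = tautology λ v → table (eval v A) (eval v B)
    where
    table : ∀ a b → not (not (not a ∨ not b)) ∨ a ≡ true
    table = truth-table 2 _

  ∧-elimʳ : ∀ {A B} → ⊢ (A ∧' B ⇒ B)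
  ∧-elimʳ {A} {B} = tautology λ v → table (eval v A) (eval v B)
    where
    table : ∀ a b → not (not (not a ∨ not b)) ∨ b ≡ true
    table = truth-table 2 _

  ⇒-∧-introʳ : ∀ {A B C} → ⊢ (B ⇒ C) → ⊢ (A ⇒ (B ⇒ A ∧' C))
  ⇒-∧-introʳ {A} {B} {C} = modus-ponens (tautology λ v → table (eval v A) (eval v B) (eval v C))
    where
    table : ∀ a b c → not (not b ∨ c) ∨ (not a ∨ (not b ∨ not (not a ∨ not c))) ≡ true
    table = truth-table 3 _

  □-mono : ∀ {A B} → ⊢ (A ⇒ B) → ⊢ (□ A ⇒ □ B)
  □-mono {A} {B} = modus-ponens (distribution A B) ∘ necessitation

  -- Löb's axiom for A ∧ □A yields 4.
  □-four : (∀ A → ⊢ (□ (□ A ⇒ A) ⇒ □ A)) → ∀ A → ⊢ (□ A ⇒ □ □ A)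
  □-four löb A = ⇒-trans (□-mono A⇒□B⇒B) (⇒-trans (löb B) (□-mono ∧-elimʳ))
    where
    B : Fm
    B = A ∧' □ A
    A⇒□B⇒B : ⊢ (A ⇒ (□ B ⇒ B))
    A⇒□B⇒B = ⇒-∧-introʳ (□-mono ∧-elimˡ)

GR⁻-containsK : ContainsK GR⁻⊢_
GR⁻-containsK = record { tautology = taut ; modus-ponens = mp ; distribution = axK ; necessitation = nec }

GR°-containsK : ContainsK GR°⊢_
GR°-containsK = record { tautology = taut ; modus-ponens = mp ; distribution = axK ; necessitation = nec }

module GR⁻ = ContainsK-Properties GR⁻-containsK
module GR° = ContainsK-Properties GR°-containsK

GR⁻⊢⇒GR°⊢ : ∀ {A} → GR⁻⊢ A → GR°⊢ A
GR⁻⊢⇒GR°⊢ (taut t)  = taut t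
GR⁻⊢⇒GR°⊢ (axK A B) = axK A B
GR⁻⊢⇒GR°⊢ (axL A)   = axL A
GR⁻⊢⇒GR°⊢ (ax1 A)   = ax1 A
GR⁻⊢⇒GR°⊢ (ax2 A)   = ax2 A
GR⁻⊢⇒GR°⊢ (ax3 A)   = ax3 A
GR⁻⊢⇒GR°⊢ (ax4 A)   = ax4 A
GR⁻⊢⇒GR°⊢ (mp p q)  = mp (GR⁻⊢⇒GR°⊢ p) (GR⁻⊢⇒GR°⊢ q)
GR⁻⊢⇒GR°⊢ (nec p)   = nec (GR⁻⊢⇒GR°⊢ p)

GR°⊢⇒GR⁻⊢□ : ∀ {A} → GR°⊢ A → GR⁻⊢ (□ A)
GR°⊢⇒GR⁻⊢□ (taut t)      = nec (taut t)
GR°⊢⇒GR⁻⊢□ (axK A B)     = nec (axK A B)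
GR°⊢⇒GR⁻⊢□ (axL A)       = nec (axL A)
GR°⊢⇒GR⁻⊢□ (ax1 A)       = nec (ax1 A)
GR°⊢⇒GR⁻⊢□ (ax2 A)       = nec (ax2 A)
GR°⊢⇒GR⁻⊢□ (ax3 A)       = nec (ax3 A)
GR°⊢⇒GR⁻⊢□ (ax4 A)       = nec (ax4 A)
GR°⊢⇒GR⁻⊢□ (mp p q)      = mp (mp (axK _ _) (GR°⊢⇒GR⁻⊢□ p)) (GR°⊢⇒GR⁻⊢□ q)
GR°⊢⇒GR⁻⊢□ (nec {A} p)   = mp (GR⁻.□-four axL A) (GR°⊢⇒GR⁻⊢□ p)
GR°⊢⇒GR⁻⊢□ (bnec {A} p)  = mp (ax2 A) (GR°⊢⇒GR⁻⊢□ p)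

τ : List Fm → Fm → Fm
τ L (var n)  = var n
τ L ⊥'       = ⊥'
τ L (¬' A)   = ¬' τ L A
τ L (A ∨' B) = τ L A ∨' τ L B
τ L (□ A)    = □ A
τ L (■ A)    = if does (A ∈? L) then ■ A ∨' □ ⊥' else ■ A

eval-τ : ∀ L v F → eval v (τ L F) ≡ eval (eval v ∘ τ L) F
eval-τ L v (var n)  = refl
eval-τ L v ⊥'       = refl
eval-τ L v (¬' F)   = cong not (eval-τ L v F)
eval-τ L v (F ∨' G) = cong₂ _∨_ (eval-τ L v F) (eval-τ L v G)
eval-τ L v (□ F)    = refl
eval-τ L v (■ F)    = refl

bnecs : ∀ {F} → GR°⊢ F → List Fm
bnecs (taut _)     = []
bnecs (axK _ _)    = []
bnecs (axL _)      = []
bnecs (ax1 _)      = []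
bnecs (ax2 _)      = []
bnecs (ax3 _)      = []
bnecs (ax4 _)      = []
bnecs (mp p q)     = bnecs p ++ bnecs q
bnecs (nec _)      = []
bnecs (bnec {A} _) = A ∷ []

bnecs-provable : ∀ {F X} (π : GR°⊢ F) → X ∈ bnecs π → GR°⊢ X
bnecs-provable (mp p q) X∈ = [ bnecs-provable p , bnecs-provable q ] (∈-++⁻ (bnecs p) X∈)
bnecs-provable (bnec p) (here refl) = p

GR°⊢⇒GR⁻⊢τ : ∀ {L F} (π : GR°⊢ F) → bnecs π ⊆ L → GR⁻⊢ τ L F
GR°⊢⇒GR⁻⊢τ {L} {F} (taut t) _ = taut λ v → trans (eval-τ L v F) (t _)
GR°⊢⇒GR⁻⊢τ (axK A B) _ = axK A B
GR°⊢⇒GR⁻⊢τ (axL A)   _ = axL A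
GR°⊢⇒GR⁻⊢τ {L} (ax1 A) _ with A ∈? L
... | yes _ = GR⁻.∨-elim (ax1 A) (GR⁻.□-mono GR⁻.⊥-elim′)
... | no _  = ax1 A
GR°⊢⇒GR⁻⊢τ (ax2 A)   _ = ax2 A
GR°⊢⇒GR⁻⊢τ {L} (ax3 A) _ with A ∈? L
... | yes _ = GR⁻.⇒-trans (ax3 A) (GR⁻.∨-mono GR⁻.⇒-refl GR⁻.∨-injˡ)
... | no _  = ax3 A
GR°⊢⇒GR⁻⊢τ (ax4 A)   _ = ax4 A
GR°⊢⇒GR⁻⊢τ (mp p q) ⊆L =
  mp (GR°⊢⇒GR⁻⊢τ p (⊆L ∘ ∈-++⁺ˡ)) (GR°⊢⇒GR⁻⊢τ q (⊆L ∘ ∈-++⁺ʳ (bnecs p)))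
GR°⊢⇒GR⁻⊢τ (nec p)   _ = GR°⊢⇒GR⁻⊢□ p
GR°⊢⇒GR⁻⊢τ {L} (bnec {A} p) ⊆L with A ∈? L
... | yes _  = mp GR⁻.∨-comm (mp (ax3 A) (GR°⊢⇒GR⁻⊢□ p))
... | no A∉L = ⊥-elim (A∉L (⊆L (here refl)))

τ-fixes-IsTop : ∀ {L A Aᵀ} → (∀ {X} → X ∈ L → GR°⊢ X) → IsTop A Aᵀ → τ L Aᵀ ≡ Aᵀ
τ-fixes-IsTop ⊢L (t-var n)   = refl
τ-fixes-IsTop ⊢L t-⊥         = refl
τ-fixes-IsTop ⊢L (t-¬ t)     = cong ¬'_ (τ-fixes-IsTop ⊢L t)
τ-fixes-IsTop ⊢L (t-∨ t u)   = cong₂ _∨'_ (τ-fixes-IsTop ⊢L t) (τ-fixes-IsTop ⊢L u)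
τ-fixes-IsTop ⊢L (t-□ t)     = refl
τ-fixes-IsTop ⊢L (t-■yes _)  = refl
τ-fixes-IsTop {L} ⊢L (t-■no {D} ⊬D) with D ∈? L
... | yes D∈L = ⊥-elim (⊬D (⊢L D∈L))
... | no _    = refl

GR°⊢ᵀ⇒GR⁻⊢ᵀ : ∀ {A Aᵀ} → IsTop A Aᵀ → GR°⊢ Aᵀ → GR⁻⊢ Aᵀ
GR°⊢ᵀ⇒GR⁻⊢ᵀ t π =
  subst GR⁻⊢_ (τ-fixes-IsTop (bnecs-provable π) t) (GR°⊢⇒GR⁻⊢τ π id)

IsTop-GR°-equivalent : ∀ {A Aᵀ} → IsTop A Aᵀ → GR°⊢ (A ⇒ Aᵀ) × GR°⊢ (Aᵀ ⇒ A)
IsTop-GR°-equivalent (t-var n)  = GR°.⇒-refl , GR°.⇒-refl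
IsTop-GR°-equivalent t-⊥        = GR°.⇒-refl , GR°.⇒-refl
IsTop-GR°-equivalent (t-¬ t)    =
  let A⇒Aᵀ , Aᵀ⇒A = IsTop-GR°-equivalent t in GR°.¬-mono Aᵀ⇒A , GR°.¬-mono A⇒Aᵀ
IsTop-GR°-equivalent (t-∨ t u)  =
  let A⇒Aᵀ , Aᵀ⇒A = IsTop-GR°-equivalent t
      B⇒Bᵀ , Bᵀ⇒B = IsTop-GR°-equivalent u
  in GR°.∨-mono A⇒Aᵀ B⇒Bᵀ , GR°.∨-mono Aᵀ⇒A Bᵀ⇒B
IsTop-GR°-equivalent (t-□ t)    =
  let A⇒Aᵀ , Aᵀ⇒A = IsTop-GR°-equivalent t in GR°.□-mono A⇒Aᵀ , GR°.□-mono Aᵀ⇒A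
IsTop-GR°-equivalent (t-■yes p) = GR°.⇒-const GR°.⊤-intro , GR°.⇒-const (bnec p)
IsTop-GR°-equivalent (t-■no _)  = GR°.⇒-refl , GR°.⇒-refl

proposition6p5 : (A Aᵀ : Fm) → IsTop A Aᵀ →
    ((GR⁻⊢ Aᵀ) ⇔ (GR°⊢ Aᵀ)) × ((GR⁻⊢ Aᵀ) ⇔ (GR°⊢ A))
proposition6p5 A Aᵀ t =
  mk⇔ GR⁻⊢⇒GR°⊢ (GR°⊢ᵀ⇒GR⁻⊢ᵀ t) ,
  mk⇔ (mp Aᵀ⇒A ∘ GR⁻⊢⇒GR°⊢) (GR°⊢ᵀ⇒GR⁻⊢ᵀ t ∘ mp A⇒Aᵀ)
  where
  A⇒Aᵀ : GR°⊢ (A ⇒ Aᵀ)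
  A⇒Aᵀ = proj₁ (IsTop-GR°-equivalent t)
  Aᵀ⇒A : GR°⊢ (Aᵀ ⇒ A)
  Aᵀ⇒A = proj₂ (IsTop-GR°-equivalent t)
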